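{- Let $G$ be a graph with $v$ vertices and $e$ edges, and let $n$ be a positive integer with $v>n$. Write $v=qn+r$ with integers $q$ and $0\le r<n$. Then \[ N(G,n)\le \left\lfloor \frac{\binom{v}{2}-e}{(n-r)\binom{\lfloor v/n\rfloor}{2}+r\binom{\lceil v/n\rceil}{2}}\right\rfloor. \]
   Context: All graphs are finite simple graphs. An $n$-coloring of a graph $G$ is a proper vertex coloring using at most $n$ colors. Two colorings $C_1,C_2$ of $G$ are orthogonal if whenever two distinct vertices share a color in $C_1$, they have distinct colors in $C_2$. $N(G,n)$ denotes the maximum size of a set of pairwise orthogonal $n$-colorings of $G$. -}

module Defs where

open import Data.Nat using (ℕ; zero; suc; _+_; _*_; _∸_; _/_; _<ᵇ_; NonZero)
open import Data.Nat.Combinatorics using (_C_)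
open import Data.Fin using (Fin; toℕ)
open import Data.List using (map; allFin)
open import Data.Nat.ListAction using (sum)
open import Data.Bool using (Bool; true; false; _∧_; if_then_else_)
open import Relation.Binary.PropositionalEquality using (_≡_; _≢_)

record Graph (v : ℕ) : Set where
  field
    adj     : Fin v → Fin v → Bool
    adj-sym : ∀ i j → adj i j ≡ adj j i
    irrefl  : ∀ i → adj i i ≡ false
open Graph public

edges : ∀ {v} → Graph v → ℕ
edges {v} G =
  sum (map (λ i → sum (map (λ j →
    if (toℕ i <ᵇ toℕ j) ∧ adj G i j then 1 else 0) (allFin v))) (allFin v))

IsColoring : ∀ {v} (n : ℕ) → Graph v → (Fin v → Fin n) → Set
IsColoring n G c = ∀ x y → adj G x y ≡ true → c x ≢ c y

Orthogonal : ∀ {v n} → (Fin v → Fin n) → (Fin v → Fin n) → Set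
Orthogonal c₁ c₂ = ∀ x y → x ≢ y → c₁ x ≡ c₁ y → c₂ x ≢ c₂ y

-- floor division, with the (irrelevant here) convention a/0 = 0
floorDiv : ℕ → ℕ → ℕ
floorDiv a zero    = 0
floorDiv a (suc b) = a / suc b

ceilDiv : ℕ → (n : ℕ) → .{{NonZero n}} → ℕ
ceilDiv v n = (v + (n ∸ 1)) / n

bound : (v e n r : ℕ) → .{{NonZero n}} → ℕ
bound v e n r =
  floorDiv ((v C 2) ∸ e)
           ((n ∸ r) * ((v / n) C 2) + r * ((ceilDiv v n) C 2))

module Submission where

-- Count unordered vertex
-- pairs {x, y}.  A pair monochromatic in some Cₜ is a non-edge (properness),
-- and it is monochromatic in at most one Cₜ (orthogonality); so the edges
-- together with the monochromatic pairs of all the Cₜ number at most C(v,2):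
--     e + Σₜ mono(Cₜ) ≤ C(v,2).
-- On the other hand mono(Cₜ) = Σₐ C(sₐ,2) over the colour classes, whose
-- sizes sₐ sum to v; by convexity of s ↦ C(s,2) this is at least the balanced
-- value D = (n−r)·C(q,2) + r·C(q+1,2).  Hence k·D ≤ C(v,2) − e, and D > 0
-- because v > n, which gives k ≤ ⌊(C(v,2) − e)/D⌋; finally D is exactly the
-- denominator of the bound, since ⌊v/n⌋ = q and ⌈v/n⌉ = q + 1 when r > 0.

open import Defs
open import Data.Nat using (ℕ; zero; suc; _+_; _*_; _∸_; _/_; _%_; _<ᵇ_; _<_; _≤_; z≤n; s≤s; NonZero)
open import Data.Nat.Properties
open import Data.Nat.DivMod using (m*n/n≡m; /-monoˡ-≤; +-distrib-/; m*n%n≡0; m<n⇒m%n≡m; m<n⇒m/n≡0)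
open import Data.Nat.Combinatorics using (_C_; nCk+nC[k+1]≡[n+1]C[k+1]; nC1≡n)
open import Data.Nat.Solver using (module +-*-Solver)
import Data.Nat.ListAction as List
open import Algebra.Properties.Semiring.Sum +-*-semiring
  using (sum-syntax; sum-cong-≗; sum-replicate-zero; ∑-distrib-+; ∑-comm; *-distribˡ-sum)
open import Data.Fin using (Fin; toℕ; zero; suc)
import Data.Fin.Properties as FinP
open import Data.List using (map; tabulate)
open import Data.Bool using (Bool; true; false; _∧_; if_then_else_)
open import Data.Empty using (⊥; ⊥-elim)
open import Relation.Nullary using (does; yes; no)
open import Relation.Binary.PropositionalEquality
open +-*-Solver using (solve; _:+_; _:*_; _:=_; con)

𝟙 : Bool → ℕ
𝟙 true  = 1
𝟙 false = 0

choose2 : ℕ → ℕ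
choose2 zero    = 0
choose2 (suc n) = n + choose2 n

choose2≡C : ∀ n → choose2 n ≡ n C 2
choose2≡C zero    = refl
choose2≡C (suc n) =
  trans (cong₂ _+_ (sym (nC1≡n n)) (choose2≡C n)) (nCk+nC[k+1]≡[n+1]C[k+1] n 1)

same : ∀ {n} → Fin n → Fin n → Bool
same x y = does (x FinP.≟ y)

same-sound : ∀ {n} (x y : Fin n) → same x y ≡ true → x ≡ y
same-sound x y with x FinP.≟ y
... | yes x≡y = λ _ → x≡y
... | no  _   = λ ()

∑-const : ∀ n c → ∑[ i < n ] c ≡ n * c
∑-const zero    c = refl
∑-const (suc n) c = cong (c +_) (∑-const n c)

∑-mono : ∀ n {f g : Fin n → ℕ} → (∀ i → f i ≤ g i) → ∑[ i < n ] f i ≤ ∑[ i < n ] g i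
∑-mono zero    f≤g = z≤n
∑-mono (suc n) f≤g = +-mono-≤ (f≤g zero) (∑-mono n (λ i → f≤g (suc i)))

-- The sum of a list built by `tabulate` is the corresponding finite sum;
-- this connects the list-based edge count of `Defs` with `∑`.
listSum-tabulate : ∀ {A : Set} n (f : A → ℕ) (g : Fin n → A) →
  List.sum (map f (tabulate g)) ≡ ∑[ i < n ] f (g i)
listSum-tabulate zero    f g = refl
listSum-tabulate (suc n) f g = cong (f (g zero) +_) (listSum-tabulate n f (λ i → g (suc i)))

∑𝟙-none : ∀ k (g : Fin k → Bool) → (∀ t → g t ≡ false) → ∑[ t < k ] 𝟙 (g t) ≡ 0
∑𝟙-none k g allFalse = trans (sum-cong-≗ (λ t → cong 𝟙 (allFalse t))) (sum-replicate-zero k)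

∑𝟙-atMostOne : ∀ k (g : Fin k → Bool) →
  (∀ t t′ → t ≢ t′ → g t ≡ true → g t′ ≡ true → ⊥) → ∑[ t < k ] 𝟙 (g t) ≤ 1
∑𝟙-atMostOne zero    g exclusive = z≤n
∑𝟙-atMostOne (suc k) g exclusive with g zero in g₀
... | true  = ≤-reflexive (cong suc (∑𝟙-none k (λ t → g (suc t)) others-false))
  where
  others-false : ∀ t → g (suc t) ≡ false
  others-false t with g (suc t) in gₜ
  ... | true  = ⊥-elim (exclusive zero (suc t) (λ ()) g₀ gₜ)
  ... | false = refl
... | false = ∑𝟙-atMostOne k (λ t → g (suc t))
                (λ t t′ t≢t′ → exclusive (suc t) (suc t′) (λ e → t≢t′ (FinP.suc-injective e)))

-- Definitionally, pairSum (suc v) f unfolds to the pairs containing vertex 0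
-- plus pairSum v on the remaining vertices; the recursive proofs use this.
pairSum : ∀ v → (Fin v → Fin v → ℕ) → ℕ
pairSum v f = ∑[ i < v ] ∑[ j < v ] (if toℕ i <ᵇ toℕ j then f i j else 0)

pairSum-cong : ∀ v {f g : Fin v → Fin v → ℕ} →
  (∀ i j → f i j ≡ g i j) → pairSum v f ≡ pairSum v g
pairSum-cong v f≡g = sum-cong-≗ (λ i → sum-cong-≗ (λ j →
  cong (λ x → if toℕ i <ᵇ toℕ j then x else 0) (f≡g i j)))

pairSum-mono : ∀ v {f g : Fin v → Fin v → ℕ} →
  (∀ i j → toℕ i < toℕ j → f i j ≤ g i j) → pairSum v f ≤ pairSum v g
pairSum-mono zero    f≤g = z≤n
pairSum-mono (suc v) f≤g =
  +-mono-≤ (∑-mono v (λ j → f≤g zero (suc j) (s≤s z≤n)))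
           (pairSum-mono v (λ i j i<j → f≤g (suc i) (suc j) (s≤s i<j)))

pairSum-+ : ∀ v (f g : Fin v → Fin v → ℕ) →
  pairSum v (λ i j → f i j + g i j) ≡ pairSum v f + pairSum v g
pairSum-+ v f g =
  trans (sum-cong-≗ (λ i → trans (sum-cong-≗ (λ j → if-+ (toℕ i <ᵇ toℕ j) (f i j) (g i j)))
                                 (∑-distrib-+ (ordered f i) (ordered g i))))
        (∑-distrib-+ (λ i → ∑[ j < v ] ordered f i j) (λ i → ∑[ j < v ] ordered g i j))
  where
  ordered : (Fin v → Fin v → ℕ) → Fin v → Fin v → ℕ
  ordered h i j = if toℕ i <ᵇ toℕ j then h i j else 0
  if-+ : ∀ b x y → (if b then x + y else 0) ≡ (if b then x else 0) + (if b then y else 0)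
  if-+ true  x y = refl
  if-+ false x y = refl

pairSum-∑ : ∀ v k (F : Fin k → Fin v → Fin v → ℕ) →
  pairSum v (λ i j → ∑[ t < k ] F t i j) ≡ ∑[ t < k ] pairSum v (F t)
pairSum-∑ v k F =
  trans (sum-cong-≗ (λ i → trans (sum-cong-≗ (λ j → if-∑ (toℕ i <ᵇ toℕ j) (λ t → F t i j)))
                                 (∑-comm (λ j t → if toℕ i <ᵇ toℕ j then F t i j else 0))))
        (∑-comm (λ i t → ∑[ j < v ] (if toℕ i <ᵇ toℕ j then F t i j else 0)))
  where
  if-∑ : ∀ b (x : Fin k → ℕ) → (if b then ∑[ t < k ] x t else 0) ≡ ∑[ t < k ] (if b then x t else 0)
  if-∑ true  x = refl
  if-∑ false x = sym (sum-replicate-zero k)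

pairSum-product : ∀ v (h : Fin v → Bool) →
  pairSum v (λ i j → 𝟙 (h i) * 𝟙 (h j)) ≡ choose2 (∑[ i < v ] 𝟙 (h i))
pairSum-product zero    h = refl
pairSum-product (suc v) h with h zero
... | false = cong₂ _+_ (sum-replicate-zero v) (pairSum-product v (λ i → h (suc i)))
... | true  = cong₂ _+_ (sum-cong-≗ (λ j → +-identityʳ (𝟙 (h (suc j)))))
                        (pairSum-product v (λ i → h (suc i)))

pairSum-one : ∀ v → pairSum v (λ _ _ → 1) ≡ choose2 v
pairSum-one v = trans (pairSum-product v (λ _ → true))
                      (cong choose2 (trans (∑-const v 1) (*-identityʳ v)))

same-via-colours : ∀ n (x y : Fin n) →
  ∑[ a < n ] (𝟙 (same x a) * 𝟙 (same y a)) ≡ 𝟙 (same x y)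
same-via-colours (suc n) zero    zero    = cong suc (sum-replicate-zero n)
same-via-colours (suc n) zero    (suc y) = sum-replicate-zero n
same-via-colours (suc n) (suc x) zero    =
  trans (sum-cong-≗ (λ a → *-zeroʳ (𝟙 (same x a)))) (sum-replicate-zero n)
same-via-colours (suc n) (suc x) (suc y) = same-via-colours n x y

same-unique : ∀ n (x : Fin n) → ∑[ a < n ] 𝟙 (same x a) ≡ 1
same-unique (suc n) zero    = cong suc (sum-replicate-zero n)
same-unique (suc n) (suc x) = same-unique n x

module _ {v n : ℕ} (c : Fin v → Fin n) where

  classSize : Fin n → ℕ
  classSize a = ∑[ i < v ] 𝟙 (same (c i) a)

  monoPairs : ℕ
  monoPairs = pairSum v (λ i j → 𝟙 (same (c i) (c j)))

  monoPairs≡∑classes : monoPairs ≡ ∑[ a < n ] choose2 (classSize a)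
  monoPairs≡∑classes = begin
    pairSum v (λ i j → 𝟙 (same (c i) (c j)))
      ≡⟨ pairSum-cong v (λ i j → sym (same-via-colours n (c i) (c j))) ⟩
    pairSum v (λ i j → ∑[ a < n ] (𝟙 (same (c i) a) * 𝟙 (same (c j) a)))
      ≡⟨ pairSum-∑ v n (λ a i j → 𝟙 (same (c i) a) * 𝟙 (same (c j) a)) ⟩
    ∑[ a < n ] pairSum v (λ i j → 𝟙 (same (c i) a) * 𝟙 (same (c j) a))
      ≡⟨ sum-cong-≗ (λ a → pairSum-product v (λ i → same (c i) a)) ⟩
    ∑[ a < n ] choose2 (classSize a) ∎
    where open ≡-Reasoning

  classSizes-total : ∑[ a < n ] classSize a ≡ v
  classSizes-total = begin
    ∑[ a < n ] ∑[ i < v ] 𝟙 (same (c i) a) ≡⟨ ∑-comm (λ a i → 𝟙 (same (c i) a)) ⟩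
    ∑[ i < v ] ∑[ a < n ] 𝟙 (same (c i) a) ≡⟨ sum-cong-≗ (λ i → same-unique n (c i)) ⟩
    ∑[ i < v ] 1                           ≡⟨ ∑-const v 1 ⟩
    v * 1                                  ≡⟨ *-identityʳ v ⟩
    v                                      ∎
    where open ≡-Reasoning

-- The number of pairs in a balanced partition of q·n + r objects into n
-- classes: n − r classes of size q and r classes of size q + 1.
balancedPairs : (n q r : ℕ) → ℕ
balancedPairs n q r = (n ∸ r) * choose2 q + r * choose2 (suc q)

-- Tangent-line bound for the convex function s ↦ C(s,2) between q and q + 1:
-- C(s,2) + C(q+1,2) − q·s = C(s−q,2) ≥ 0.
tangent-bound : ∀ s q → q * s ≤ choose2 s + choose2 (suc q)
tangent-bound zero    q       = ≤-trans (≤-reflexive (*-zeroʳ q)) z≤n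
tangent-bound (suc s) zero    = z≤n
tangent-bound (suc s) (suc q) = begin
    suc q * suc s                             ≡⟨ solve 2 (λ s q → (con 1 :+ q) :* (con 1 :+ s)
                                                   := (con 1 :+ (s :+ q)) :+ q :* s) refl s q ⟩
    suc (s + q) + q * s                       ≤⟨ +-monoʳ-≤ (suc (s + q)) (tangent-bound s q) ⟩
    suc (s + q) + (choose2 s + choose2 (suc q)) ≡⟨ solve 4 (λ s q a b → (con 1 :+ (s :+ q)) :+ (a :+ b)
                                                   := (s :+ a) :+ ((con 1 :+ q) :+ b))
                                                   refl s q (choose2 s) (choose2 (suc q)) ⟩
    choose2 (suc s) + choose2 (suc (suc q))   ∎
  where open ≤-Reasoning

choose2-double : ∀ q → choose2 q + choose2 q + q ≡ q * q
choose2-double zero    = refl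
choose2-double (suc q) = begin
    (q + choose2 q) + (q + choose2 q) + suc q
      ≡⟨ solve 2 (λ q x → (q :+ x) :+ (q :+ x) :+ (con 1 :+ q)
                         := (x :+ x :+ q) :+ (con 1 :+ (q :+ q))) refl q (choose2 q) ⟩
    (choose2 q + choose2 q + q) + suc (q + q)
      ≡⟨ cong (_+ suc (q + q)) (choose2-double q) ⟩
    q * q + suc (q + q)
      ≡⟨ solve 1 (λ q → q :* q :+ (con 1 :+ (q :+ q)) := (con 1 :+ q) :* (con 1 :+ q)) refl q ⟩
    suc q * suc q ∎
  where open ≡-Reasoning

-- Summing the tangent bound over the n classes is exact for the balanced
-- partition: D + n·C(q+1,2) = q·(q·n + r).
balanced-identity : ∀ n q r → r ≤ n →
  balancedPairs n q r + n * choose2 (suc q) ≡ q * (q * n + r)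
balanced-identity n q r r≤n = begin
    m * x + r * (q + x) + n * (q + x)
      ≡⟨ cong (λ n′ → m * x + r * (q + x) + n′ * (q + x)) (sym r+m≡n) ⟩
    m * x + r * (q + x) + (r + m) * (q + x)
      ≡⟨ solve 4 (λ q r m x → m :* x :+ r :* (q :+ x) :+ (r :+ m) :* (q :+ x)
                            := (r :+ m) :* (x :+ x :+ q) :+ q :* r) refl q r m x ⟩
    (r + m) * (x + x + q) + q * r
      ≡⟨ cong₂ (λ n′ y → n′ * y + q * r) r+m≡n (choose2-double q) ⟩
    n * (q * q) + q * r
      ≡⟨ solve 3 (λ n q r → n :* (q :* q) :+ q :* r := q :* (q :* n :+ r)) refl n q r ⟩
    q * (q * n + r) ∎
  where
  open ≡-Reasoning
  m = n ∸ r
  x = choose2 q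
  r+m≡n : r + m ≡ n
  r+m≡n = m+[n∸m]≡n r≤n

balanced-minimum : ∀ n q r (s : Fin n → ℕ) → r ≤ n → ∑[ a < n ] s a ≡ q * n + r →
  balancedPairs n q r ≤ ∑[ a < n ] choose2 (s a)
balanced-minimum n q r s r≤n total = +-cancelʳ-≤ (n * y) _ _ (begin
    balancedPairs n q r + n * y           ≡⟨ balanced-identity n q r r≤n ⟩
    q * (q * n + r)                       ≡⟨ cong (q *_) (sym total) ⟩
    q * ∑[ a < n ] s a                    ≡⟨ *-distribˡ-sum q s ⟩
    ∑[ a < n ] (q * s a)                  ≤⟨ ∑-mono n (λ a → tangent-bound (s a) q) ⟩
    ∑[ a < n ] (choose2 (s a) + y)        ≡⟨ ∑-distrib-+ (λ a → choose2 (s a)) (λ _ → y) ⟩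
    ∑[ a < n ] choose2 (s a) + ∑[ a < n ] y ≡⟨ cong (∑[ a < n ] choose2 (s a) +_) (∑-const n y) ⟩
    ∑[ a < n ] choose2 (s a) + n * y      ∎)
  where
  open ≤-Reasoning
  y = choose2 (suc q)

monoPairs-lower : ∀ {n} q r (c : Fin (q * n + r) → Fin n) → r ≤ n →
  balancedPairs n q r ≤ monoPairs c
monoPairs-lower {n} q r c r≤n =
  subst (balancedPairs n q r ≤_) (sym (monoPairs≡∑classes c))
        (balanced-minimum n q r (classSize c) r≤n (classSizes-total c))

edges≡pairSum : ∀ {v} (G : Graph v) → edges G ≡ pairSum v (λ i j → 𝟙 (adj G i j))
edges≡pairSum {v} G =
  trans (listSum-tabulate v _ (λ i → i))
        (sum-cong-≗ (λ i → trans (listSum-tabulate v _ (λ j → j))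
                                 (sum-cong-≗ (λ j → if-∧ (toℕ i <ᵇ toℕ j) (adj G i j)))))
  where
  if-∧ : ∀ b e → (if b ∧ e then 1 else 0) ≡ (if b then 𝟙 e else 0)
  if-∧ true  true  = refl
  if-∧ true  false = refl
  if-∧ false e     = refl

module _ {v n k : ℕ} (G : Graph v) (χ : Fin k → Fin v → Fin n)
         (proper : ∀ t → IsColoring n G (χ t))
         (orthogonal : ∀ t t′ → t ≢ t′ → Orthogonal (χ t) (χ t′)) where

  -- A pair of distinct vertices is an edge or monochromatic in some χₜ, but
  -- at most one of these: an edge is never monochromatic (properness), and
  -- a pair is monochromatic in at most one χₜ (orthogonality).
  pair-charge : ∀ x y → x ≢ y →
    𝟙 (adj G x y) + ∑[ t < k ] 𝟙 (same (χ t x) (χ t y)) ≤ 1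
  pair-charge x y x≢y with adj G x y in edge
  ... | true  = ≤-reflexive (cong suc (∑𝟙-none k (λ t → same (χ t x) (χ t y)) never-mono))
    where
    never-mono : ∀ t → same (χ t x) (χ t y) ≡ false
    never-mono t with same (χ t x) (χ t y) in mono
    ... | true  = ⊥-elim (proper t x y edge (same-sound _ _ mono))
    ... | false = refl
  ... | false = ∑𝟙-atMostOne k (λ t → same (χ t x) (χ t y))
                  (λ t t′ t≢t′ mono mono′ →
                     orthogonal t t′ t≢t′ x y x≢y (same-sound _ _ mono) (same-sound _ _ mono′))

  pair-budget : edges G + ∑[ t < k ] monoPairs (χ t) ≤ v C 2
  pair-budget = begin
    edges G + ∑[ t < k ] monoPairs (χ t)
      ≡⟨ cong₂ _+_ (edges≡pairSum G) (sym (pairSum-∑ v k mono)) ⟩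
    pairSum v edge + pairSum v (λ x y → ∑[ t < k ] mono t x y)
      ≡⟨ sym (pairSum-+ v edge (λ x y → ∑[ t < k ] mono t x y)) ⟩
    pairSum v (λ x y → edge x y + ∑[ t < k ] mono t x y)
      ≤⟨ pairSum-mono v (λ x y x<y → pair-charge x y (λ x≡y → <-irrefl (cong toℕ x≡y) x<y)) ⟩
    pairSum v (λ _ _ → 1) ≡⟨ pairSum-one v ⟩
    choose2 v             ≡⟨ choose2≡C v ⟩
    v C 2                 ∎
    where
    open ≤-Reasoning
    edge : Fin v → Fin v → ℕ
    edge x y = 𝟙 (adj G x y)
    mono : Fin k → Fin v → Fin v → ℕ
    mono t x y = 𝟙 (same (χ t x) (χ t y))

quotient-exact : ∀ q n r .{{_ : NonZero n}} → r < n → (q * n + r) / n ≡ q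
quotient-exact q n r r<n = begin
    (q * n + r) / n   ≡⟨ +-distrib-/ (q * n) r remainders-small ⟩
    q * n / n + r / n ≡⟨ cong₂ _+_ (m*n/n≡m q n) (m<n⇒m/n≡0 r<n) ⟩
    q + 0             ≡⟨ +-identityʳ q ⟩
    q                 ∎
  where
  open ≡-Reasoning
  remainders-small : (q * n) % n + r % n < n
  remainders-small = subst (_< n) (sym (cong₂ _+_ (m*n%n≡0 q n) (m<n⇒m%n≡m r<n))) r<n

ceiling-exact : ∀ q n r .{{_ : NonZero n}} → 0 < r → r < n → ceilDiv (q * n + r) n ≡ suc q
ceiling-exact q (suc n) (suc r) _ r<n = begin
    (q * suc n + suc r + n) / suc n ≡⟨ cong (_/ suc n) (solve 3 (λ q n r →
                                         q :* (con 1 :+ n) :+ (con 1 :+ r) :+ n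
                                         := (con 1 :+ q) :* (con 1 :+ n) :+ r) refl q n r) ⟩
    (suc q * suc n + r) / suc n     ≡⟨ quotient-exact (suc q) (suc n) r (<-trans (n<1+n r) r<n) ⟩
    suc q                           ∎
  where open ≡-Reasoning

denominator≡balancedPairs : ∀ q n r .{{_ : NonZero n}} → r < n →
  (n ∸ r) * ((q * n + r) / n C 2) + r * (ceilDiv (q * n + r) n C 2) ≡ balancedPairs n q r
denominator≡balancedPairs q n r r<n =
  cong₂ _+_ (cong ((n ∸ r) *_) (trans (cong (_C 2) (quotient-exact q n r r<n)) (sym (choose2≡C q))))
            (ceiling-term r r<n)
  where
  -- the ceiling only matters when r > 0
  ceiling-term : ∀ r → r < n → r * (ceilDiv (q * n + r) n C 2) ≡ r * choose2 (suc q)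
  ceiling-term zero    _   = refl
  ceiling-term (suc r) r<n = cong (suc r *_)
    (trans (cong (_C 2) (ceiling-exact q n (suc r) (s≤s z≤n) r<n)) (sym (choose2≡C (suc q))))

-- Since there are more vertices than colours, the balanced partition has a
-- class with at least two elements, so the denominator is positive.
balancedPairs-positive : ∀ n q r → r < n → n < q * n + r → 0 < balancedPairs n q r
balancedPairs-positive n zero          r       r<n n<v = ⊥-elim (<-asym r<n n<v)
balancedPairs-positive n (suc zero)    zero    r<n n<v =
  ⊥-elim (<-irrefl (sym (trans (+-identityʳ (n + 0)) (+-identityʳ n))) n<v)
balancedPairs-positive n (suc zero)    (suc r) r<n n<v =
  ≤-trans (s≤s z≤n) (m≤n+m (suc r * 1) ((n ∸ suc r) * 0))
balancedPairs-positive n (suc (suc q)) r       r<n n<v =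
  ≤-trans (*-mono-≤ (m<n⇒0<n∸m r<n) (s≤s (z≤n {q + choose2 (suc q)})))
          (m≤m+n ((n ∸ r) * choose2 (suc (suc q))) (r * choose2 (suc (suc (suc q)))))

floorDiv-greatest : ∀ a b k → 0 < b → k * b ≤ a → k ≤ floorDiv a b
floorDiv-greatest a (suc b) k _ kb≤a =
  subst (_≤ a / suc b) (m*n/n≡m k (suc b)) (/-monoˡ-≤ (suc b) kb≤a)

-- Theorem 1.4: k ≤ ⌊(C(v,2) − e)/D⌋, from k·D ≤ Σₜ mono(χₜ) ≤ C(v,2) − e.
theorem1p4 : (v n : ℕ) .{{_ : NonZero n}} (G : Graph v) (q r : ℕ) →
    n < v → v ≡ q * n + r → r < n →
    (k : ℕ) (C : Fin k → Fin v → Fin n) →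
    (∀ i → IsColoring n G (C i)) →
    (∀ i j → (∀ x → C i x ≡ C j x) → i ≡ j) →
    (∀ i j → i ≢ j → Orthogonal (C i) (C j)) →
    k ≤ bound v (edges G) n r
theorem1p4 _ n G q r n<v refl r<n k χ proper _ orthogonal =
  subst (λ d → k ≤ floorDiv (v C 2 ∸ edges G) d) (sym denominator)
    (floorDiv-greatest (v C 2 ∸ edges G) D k
      (balancedPairs-positive n q r r<n n<v)
      (m+n≤o⇒m≤o∸n (k * D) (begin
        k * D + edges G                     ≡⟨ cong (_+ edges G) (sym (∑-const k D)) ⟩
        ∑[ t < k ] D + edges G              ≤⟨ +-monoˡ-≤ (edges G) (∑-mono k each-colouring) ⟩
        ∑[ t < k ] monoPairs (χ t) + edges G ≡⟨ +-comm _ (edges G) ⟩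
        edges G + ∑[ t < k ] monoPairs (χ t) ≤⟨ pair-budget G χ proper orthogonal ⟩
        v C 2                               ∎)))
  where
  open ≤-Reasoning
  v = q * n + r
  D = balancedPairs n q r
  denominator = denominator≡balancedPairs q n r r<n
  each-colouring : ∀ t → D ≤ monoPairs (χ t)
  each-colouring t = monoPairs-lower q r (χ t) (<⇒≤ r<n)
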